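{- Let $(u,x)\in\mathrm{Bur}_n$ and $(v,y)\in\mathrm{Bur}_k$. Then $$(v,y)\le(u,x)\iff (v,y)^T\le(u,x)^T.$$
   Context: A Cayley permutation of length $n$ is a word of positive integers in which every integer from $1$ to its maximum occurs; $\mathrm{Cay}_n$ is the set of these and $\mathrm{WI}_n$ the weakly increasing ones. $\mathrm{Des}(v)=\{i: v(i)\ge v(i+1)\}$. Burge words: $\mathrm{Bur}_n=\{(u,v)\in\mathrm{WI}_n\times\mathrm{Cay}_n:\mathrm{Des}(u)\subseteq\mathrm{Des}(v)\}$, viewed as sequences of columns $\binom{u(i)}{v(i)}$. The Burge transpose $(u,v)^T$ is obtained by turning every column upside down and then sorting the columns in increasing order of top entry, ties broken by decreasing bottom entry; it maps $\mathrm{Bur}_n$ to itself. Two words are order isomorphic if they have the same length, same relative order and same equalities among entries. For $(u',v')\in\mathrm{Bur}_k$ and $(u,v)\in\mathrm{Bur}_n$, $(u',v')\le(u,v)$ means there are indices $i_1<\cdots<i_k$ with $u(i_1)\cdots u(i_k)$ order isomorphic to $u'$ and $v(i_1)\cdots v(i_k)$ order isomorphic to $v'$. -}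

module Defs where

open import Data.Nat using (ℕ; zero; suc; _≤_; _<_; _⊔_; _<?_; _≟_; _≤?_)
open import Data.Product using (_×_; _,_; proj₁; proj₂; Σ; ∃)
open import Data.Sum using (_⊎_)
open import Data.Bool using (Bool; true; false; _∨_; _∧_)
open import Data.List using (List; []; _∷_; map; length; foldr; lookup)
open import Data.List.Relation.Unary.All using (All)
open import Data.List.Relation.Unary.Linked using (Linked)
open import Data.List.Membership.Propositional using (_∈_)
open import Data.Fin using (Fin) renaming (_<_ to _<ᶠ_)
open import Relation.Binary.PropositionalEquality using (_≡_)
open import Relation.Nullary.Decidable using (⌊_⌋)
open import Function.Bundles using (_⇔_)

-- A word is a list of natural numbers; position i (0-based) is `lookup w i`.
Word : Set
Word = List ℕ

maxW : Word → ℕ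
maxW = foldr _⊔_ 0

IsCayley : Word → Set
IsCayley w = All (λ x → 1 ≤ x) w × (∀ m → 1 ≤ m → m ≤ maxW w → m ∈ w)

IsWI : Word → Set
IsWI w = Linked _≤_ w

-- A two-line word is a list of columns (top , bottom).
Column : Set
Column = ℕ × ℕ

TwoLine : Set
TwoLine = List Column

tops : TwoLine → Word
tops = map proj₁

bots : TwoLine → Word
bots = map proj₂

-- Des(u) ⊆ Des(v) expressed on adjacent columns:
-- if i is a descent of u (u(i) ≥ u(i+1)) then i is a descent of v.
DesStep : Column → Column → Set
DesStep (a , b) (a' , b') = a' ≤ a → b' ≤ b

Bur : ℕ → TwoLine → Set
Bur n c = length c ≡ n
        × IsCayley (tops c) × IsWI (tops c)
        × IsCayley (bots c)
        × Linked DesStep c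

-- Burge transpose: turn every column upside down, then sort columns in
-- increasing order of top entry, ties broken by decreasing bottom entry.
flipCol : Column → Column
flipCol (a , b) = (b , a)

before : Column → Column → Bool
before (a , b) (c , d) = ⌊ a <? c ⌋ ∨ (⌊ a ≟ c ⌋ ∧ ⌊ d ≤? b ⌋)

insertCol : Column → TwoLine → TwoLine
insertCol x [] = x ∷ []
insertCol x (y ∷ ys) with before x y
... | true  = x ∷ y ∷ ys
... | false = y ∷ insertCol x ys

sortCols : TwoLine → TwoLine
sortCols = foldr insertCol []

transposeB : TwoLine → TwoLine
transposeB c = sortCols (map flipCol c)

OrdIsoAt : (r : Column → ℕ) (small big : TwoLine)
         → (Fin (length small) → Fin (length big)) → Set
OrdIsoAt r small big f = ∀ i j →
    ((r (lookup small i) < r (lookup small j)) ⇔ (r (lookup big (f i)) < r (lookup big (f j))))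
  × ((r (lookup small i) ≡ r (lookup small j)) ⇔ (r (lookup big (f i)) ≡ r (lookup big (f j))))

_≼_ : TwoLine → TwoLine → Set
small ≼ big =
  Σ (Fin (length small) → Fin (length big)) λ f →
      (∀ i j → i <ᶠ j → f i <ᶠ f j)
    × OrdIsoAt proj₁ small big f
    × OrdIsoAt proj₂ small big f

-- The pattern order ≼ only sees, row by row, how the chosen columns compare.  An
-- occurrence of a pattern is therefore a matching of its columns with columns of the
-- big word that is an order isomorphism on each row.  Turning all columns upside down
-- keeps such a matching (it just exchanges the rows), and insertion sort treats both
-- sides of the matching alike: every comparison it makes between pattern columns has
-- the same outcome as the corresponding comparison between their images.  Hence the
-- sorted, flipped pattern occurs in the sorted, flipped word, i.e. the Burge transpose
-- is monotone for ≼.  A Burge word is already sorted for the column order used by the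
-- transpose, so the transpose is an involution on Burge words, and monotonicity of the
-- transpose applied to the transposed words gives the converse.
module Submission where

open import Defs
open import Level using (Level; 0ℓ)
open import Data.Bool using (true; false; _∨_; _∧_)
open import Data.Nat using (ℕ; zero; suc; _<_; s≤s; z≤n)
import Data.Nat.Properties as ℕ
open import Data.Fin using (Fin; zero; suc; toℕ) renaming (_<_ to _<ᶠ_)
open import Data.Product using (_×_; _,_; proj₁; proj₂; Σ; ∃-syntax)
import Data.Product as Prod
open import Data.Product.Properties using (≡-dec)
open import Data.Product.Relation.Binary.Pointwise.NonDependent using (≡×≡⇒≡)
open import Data.Product.Relation.Binary.Lex.Strict
  using (×-Lex; ×-reflexive; ×-transitive; ×-antisymmetric; ×-total₂; ×-decidable)
open import Data.Sum using (inj₁; inj₂)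
open import Data.List as List using (List; []; _∷_; [_]; length; lookup)
open import Data.List.Properties using (map-∘; map-id)
open import Data.List.Relation.Unary.All using (All; []; _∷_)
import Data.List.Relation.Unary.All as All
open import Data.List.Relation.Unary.Any using (here; there)
import Data.List.Relation.Unary.Linked as Linked
open import Data.List.Relation.Unary.Linked.Properties using (Linked⇒All; map⁻)
open import Data.List.Membership.Propositional using (_∈_)
open import Data.List.Membership.Propositional.Properties using (∈-map⁻)
open import Data.List.Relation.Binary.Subset.Propositional using (_⊆_)
open import Data.List.Relation.Binary.Subset.Propositional.Properties
  using (⊆-refl; ⊆-trans; ⊆-reflexive; ⊆-reflexive-↭; ∷⁺ʳ)
open import Data.List.Relation.Binary.Permutation.Propositional
  using (_↭_; ↭-refl; ↭-swap; ↭-trans; ↭⇒↭ₛ)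
open import Data.List.Relation.Binary.Permutation.Propositional.Properties using (map⁺)
open import Data.List.Relation.Binary.Pointwise using (Pointwise-≡⇒≡)
open import Data.List.Relation.Unary.Sorted.TotalOrder.Properties using (↗↭↗⇒≋)
open import Function.Base using (id; flip)
open import Function.Bundles using (_⇔_; mk⇔; Equivalence)
open import Relation.Binary.Bundles using (DecTotalOrder)
open import Relation.Binary.Core using (Rel; _Preserves_⟶_)
open import Relation.Binary.Definitions using (Decidable)
open import Relation.Binary.PropositionalEquality
  using (_≡_; refl; sym; trans; cong; cong₂; subst; subst₂; isEquivalence; resp₂)
open import Relation.Nullary.Decidable using (yes; no; does; dec-true; isYes≗does)
open import Relation.Nullary.Negation using (contradiction)

private variable a : Level

infixr 5 _∷ʳ_

data Embedding {A : Set a} : List A → List A → Set a where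
  []   : ∀ {ys} → Embedding [] ys
  _∷ʳ_ : ∀ {xs ys} y → Embedding xs ys → Embedding xs (y ∷ ys)
  keep : ∀ {xs ys} x y → Embedding xs ys → Embedding (x ∷ xs) (y ∷ ys)

matched : ∀ {A : Set a} {xs ys : List A} → Embedding xs ys → List (A × A)
matched []           = []
matched (_ ∷ʳ e)     = matched e
matched (keep x y e) = (x , y) ∷ matched e

map-embedding : ∀ {A B : Set a} {xs ys} (f : A → B) → Embedding xs ys →
                Embedding (List.map f xs) (List.map f ys)
map-embedding f []           = []
map-embedding f (y ∷ʳ e)     = f y ∷ʳ map-embedding f e
map-embedding f (keep x y e) = keep (f x) (f y) (map-embedding f e)

matched-map-embedding : ∀ {A B : Set a} {xs ys} (f : A → B) (e : Embedding xs ys) →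
                        matched (map-embedding f e) ≡ List.map (Prod.map f f) (matched e)
matched-map-embedding f []           = refl
matched-map-embedding f (y ∷ʳ e)     = matched-map-embedding f e
matched-map-embedding f (keep x y e) = cong ((f x , f y) ∷_) (matched-map-embedding f e)

positions : ∀ {A : Set a} {xs ys : List A} → Embedding xs ys → Fin (length xs) → Fin (length ys)
positions (_ ∷ʳ e)     i       = suc (positions e i)
positions (keep _ _ e) zero    = zero
positions (keep _ _ e) (suc i) = suc (positions e i)

positions-mono : ∀ {A : Set a} {xs ys : List A} (e : Embedding xs ys) →
                 positions e Preserves _<ᶠ_ ⟶ _<ᶠ_
positions-mono (_ ∷ʳ e)     i<j                       = s≤s (positions-mono e i<j)
positions-mono (keep _ _ e) {zero}  {suc _} _         = s≤s z≤n
positions-mono (keep _ _ e) {suc _} {suc _} (s≤s i<j) = s≤s (positions-mono e i<j)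

lookup-positions-∈ : ∀ {A : Set a} {xs ys : List A} (e : Embedding xs ys) i →
                     (lookup xs i , lookup ys (positions e i)) ∈ matched e
lookup-positions-∈ (_ ∷ʳ e)     i       = lookup-positions-∈ e i
lookup-positions-∈ (keep _ _ e) zero    = here refl
lookup-positions-∈ (keep _ _ e) (suc i) = there (lookup-positions-∈ e i)

predFin : ∀ {n} (j : Fin (suc n)) → 0 < toℕ j → Fin n
predFin (suc j) _ = j

predFin-mono : ∀ {n} (j k : Fin (suc n)) (0<j : 0 < toℕ j) (0<k : 0 < toℕ k) →
               j <ᶠ k → predFin j 0<j <ᶠ predFin k 0<k
predFin-mono (suc j) (suc k) _ _ (s≤s j<k) = j<k

lookup-predFin : ∀ {A : Set a} (y : A) ys (j : Fin (suc (length ys))) (0<j : 0 < toℕ j) →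
                 lookup (y ∷ ys) j ≡ lookup ys (predFin j 0<j)
lookup-predFin y ys (suc j) _ = refl

embeddingAt : ∀ {A : Set a} (xs ys : List A) (f : Fin (length xs) → Fin (length ys)) →
              f Preserves _<ᶠ_ ⟶ _<ᶠ_ →
              Σ (Embedding xs ys) λ e →
                ∀ {p} → p ∈ matched e → ∃[ i ] p ≡ (lookup xs i , lookup ys (f i))
embeddingAt [] ys f _ = [] , λ ()
embeddingAt (x ∷ xs) [] f _ with f zero
... | ()
embeddingAt (x ∷ xs) (y ∷ ys) f f-mono with f zero in f0≡
... | zero = keep x y e , λ
  { (here refl) → zero , cong (λ k → x , lookup (y ∷ ys) k) (sym f0≡)
  ; (there p∈) → let i , p≡ = e-at p∈ in
      suc i , trans p≡ (cong (lookup xs i ,_) (sym (lookup-predFin y ys (f (suc i)) (f>0 i)))) }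
  where
  f>0 : ∀ i → 0 < toℕ (f (suc i))
  f>0 i = subst (λ k → toℕ k < toℕ (f (suc i))) f0≡ (f-mono (s≤s z≤n))
  rec = embeddingAt xs ys (λ i → predFin (f (suc i)) (f>0 i))
                    (λ {i} {j} i<j → predFin-mono _ _ (f>0 i) (f>0 j) (f-mono (s≤s i<j)))
  e = proj₁ rec
  e-at = proj₂ rec
... | suc _ = y ∷ʳ e , λ p∈ → let i , p≡ = e-at p∈ in
      i , trans p≡ (cong (lookup (x ∷ xs) i ,_) (sym (lookup-predFin y ys (f i) (f>0 i))))
  where
  f>0 : ∀ i → 0 < toℕ (f i)
  f>0 zero    = subst (λ k → 0 < toℕ k) (sym f0≡) (s≤s z≤n)
  f>0 (suc i) = ℕ.≤-trans (s≤s z≤n) (f-mono (s≤s z≤n))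
  rec = embeddingAt (x ∷ xs) ys (λ i → predFin (f i) (f>0 i))
                    (λ {i} {j} i<j → predFin-mono _ _ (f>0 i) (f>0 j) (f-mono i<j))
  e = proj₁ rec
  e-at = proj₂ rec

module InsertionSortEmbedding {a ℓ₁ ℓ₂} (O : DecTotalOrder a ℓ₁ ℓ₂) where

  open DecTotalOrder O using (_≤_; _≤?_; totalOrder) renaming (Carrier to A; trans to ≤-trans)
  open import Data.List.Sort.InsertionSort.Base O using (insert; sort)
  open import Data.List.Sort.InsertionSort.Properties O using (sort-↗)
  open import Data.List.Relation.Unary.Sorted.TotalOrder totalOrder using (Sorted)

  OrderAgree : A × A → A × A → Set ℓ₂
  OrderAgree (x , y) (x′ , y′) = (x ≤ x′) ⇔ (y ≤ y′)

  insert-∷ʳ : ∀ y {xs ys} (e : Embedding xs ys) →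
              ∃[ e′ ] matched {xs = xs} {insert y ys} e′ ≡ matched e
  insert-∷ʳ y [] = [] , refl
  insert-∷ʳ y (z ∷ʳ e) with y ≤? z
  ... | yes _ = y ∷ʳ z ∷ʳ e , refl
  ... | no  _ = Prod.map (z ∷ʳ_) id (insert-∷ʳ y e)
  insert-∷ʳ y (keep x z e) with y ≤? z
  ... | yes _ = y ∷ʳ keep x z e , refl
  ... | no  _ = Prod.map (keep x z) (cong ((x , z) ∷_)) (insert-∷ʳ y e)

  insert-singleton : ∀ x y ys → ∃[ e ] matched {xs = [ x ]} {insert y ys} e ≡ [ (x , y) ]
  insert-singleton x y [] = keep x y [] , refl
  insert-singleton x y (z ∷ ys) with y ≤? z
  ... | yes _ = keep x y [] , refl
  ... | no  _ = Prod.map (z ∷ʳ_) id (insert-singleton x y ys)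

  insert-head : ∀ {x y xs ys} (e : Embedding xs ys) → All (y ≤_) ys →
                All (OrderAgree (x , y)) (matched e) → insert x xs ≡ x ∷ xs
  insert-head []            _          _           = refl
  insert-head (_ ∷ʳ e)      (_ ∷ y≤ys) agrees      = insert-head e y≤ys agrees
  insert-head {x} (keep x₁ _ _) (y≤y₁ ∷ _) (agree ∷ _)
    rewrite dec-true (x ≤? x₁) (Equivalence.from agree y≤y₁) = refl

  -- Where y lands in ys is decided by the comparisons y ≤ y₁ with the matched y₁,
  -- and these agree with the comparisons x ≤ x₁ that decide where x lands in xs.
  insert-keep : ∀ x y {xs ys} (e : Embedding xs ys) → Sorted ys → All (OrderAgree (x , y)) (matched e) →
                ∃[ e′ ] matched {xs = insert x xs} {insert y ys} e′ ⊆ (x , y) ∷ matched e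
  insert-keep x y {ys = ys} [] _ _ = Prod.map id ⊆-reflexive (insert-singleton x y ys)
  insert-keep x y (z ∷ʳ e) ys↗ agrees with y ≤? z
  ... | yes y≤z rewrite insert-head e (All.tail (Linked⇒All ≤-trans y≤z ys↗)) agrees =
    keep x y (z ∷ʳ e) , ⊆-refl
  ... | no _ = Prod.map (z ∷ʳ_) id (insert-keep x y e (Linked.tail ys↗) agrees)
  insert-keep x y (keep x₁ y₁ e) ys↗ (agree ∷ agrees) with x ≤? x₁ | y ≤? y₁
  ... | yes _    | yes _    = keep x y (keep x₁ y₁ e) , ⊆-refl
  ... | yes x≤x₁ | no y≰y₁  = contradiction (Equivalence.to agree x≤x₁) y≰y₁
  ... | no x≰x₁  | yes y≤y₁ = contradiction (Equivalence.from agree y≤y₁) x≰x₁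
  ... | no _     | no _     =
    let e′ , sub = insert-keep x y e (Linked.tail ys↗) agrees
    in keep x₁ y₁ e′ , ⊆-trans (∷⁺ʳ _ sub) (⊆-reflexive-↭ (↭-swap _ _ ↭-refl))

  sort-embedding : ∀ {xs ys} (e : Embedding xs ys) →
                   (∀ {p q} → p ∈ matched e → q ∈ matched e → OrderAgree p q) →
                   ∃[ e′ ] matched {xs = sort xs} {sort ys} e′ ⊆ matched e
  sort-embedding [] _ = [] , ⊆-refl
  sort-embedding (y ∷ʳ e) agree =
    let e′ , sub = sort-embedding e agree
        e″ , eq  = insert-∷ʳ y e′
    in e″ , subst (_⊆ matched e) (sym eq) sub
  sort-embedding {ys = _ ∷ ys} (keep x y e) agree =
    let e′ , sub  = sort-embedding e (λ p∈ q∈ → agree (there p∈) (there q∈))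
        e″ , sub′ = insert-keep x y e′ (sort-↗ ys)
                      (All.tabulate (λ q∈ → agree (here refl) (there (sub q∈))))
    in e″ , ⊆-trans sub′ (∷⁺ʳ _ sub)

open import Data.Nat using (_≤_; _≥_; _≟_; _<?_; _≤?_)

_⊴_ : Rel Column 0ℓ
_⊴_ = ×-Lex _≡_ _<_ _≥_

_⊴?_ : Decidable _⊴_
_⊴?_ = ×-decidable _≟_ _<?_ (flip _≤?_)

columnOrder : DecTotalOrder 0ℓ 0ℓ 0ℓ
columnOrder = record
  { Carrier = Column
  ; _≈_ = _≡_
  ; _≤_ = _⊴_
  ; isDecTotalOrder = record
    { isTotalOrder = record
      { isPartialOrder = record
        { isPreorder = record
          { isEquivalence = isEquivalence
          ; reflexive = λ { refl → ×-reflexive _≡_ _<_ _≥_ ℕ.≤-reflexive (refl , refl) }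
          ; trans = ×-transitive {_<₂_ = _≥_} isEquivalence (resp₂ _<_) ℕ.<-trans (flip ℕ.≤-trans)
          }
        ; antisym = λ p q → ≡×≡⇒≡
            (×-antisymmetric {_≈₁_ = _≡_} {_<₁_ = _<_} {_≈₂_ = _≡_} {_<₂_ = _≥_}
                             sym ℕ.<-irrefl ℕ.<-asym (flip ℕ.≤-antisym) p q)
        }
      ; total = ×-total₂ sym ℕ.<-cmp (flip ℕ.≤-total)
      }
    ; _≟_ = ≡-dec _≟_ _≟_
    ; _≤?_ = _⊴?_
    }
  }

open DecTotalOrder columnOrder using (totalOrder)
open import Data.List.Sort.InsertionSort.Base columnOrder using (insert; sort)
open import Data.List.Sort.InsertionSort.Properties columnOrder using (sort-↭; sort-↗)
open import Data.List.Relation.Unary.Sorted.TotalOrder totalOrder using (Sorted)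
open InsertionSortEmbedding columnOrder using (OrderAgree; sort-embedding)

before≡does-⊴? : ∀ x y → before x y ≡ does (x ⊴? y)
before≡does-⊴? (a , b) (c , d) =
  cong₂ _∨_ (isYes≗does (a <? c)) (cong₂ _∧_ (isYes≗does (a ≟ c)) (isYes≗does (d ≤? b)))

insertCol≡insert : ∀ x cs → insertCol x cs ≡ insert x cs
insertCol≡insert x [] = refl
insertCol≡insert x (y ∷ cs) with before x y | does (x ⊴? y) | before≡does-⊴? x y
... | true  | _ | refl = refl
... | false | _ | refl = cong (y ∷_) (insertCol≡insert x cs)

sortCols≡sort : ∀ cs → sortCols cs ≡ sort cs
sortCols≡sort [] = refl
sortCols≡sort (c ∷ cs) rewrite sortCols≡sort cs = insertCol≡insert c (sort cs)

sorted-↭-unique : ∀ {xs ys} → Sorted xs → Sorted ys → xs ↭ ys → xs ≡ ys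
sorted-↭-unique xs↗ ys↗ xs↭ys = Pointwise-≡⇒≡ (↗↭↗⇒≋ totalOrder xs↗ ys↗ (↭⇒↭ₛ xs↭ys))

map-flipCol-involutive : ∀ cs → List.map flipCol (List.map flipCol cs) ≡ cs
map-flipCol-involutive cs = trans (sym (map-∘ cs)) (map-id cs)

transposeB-↗ : ∀ cs → Sorted (transposeB cs)
transposeB-↗ cs rewrite sortCols≡sort (List.map flipCol cs) = sort-↗ (List.map flipCol cs)

transposeB-↭ : ∀ cs → transposeB cs ↭ List.map flipCol cs
transposeB-↭ cs rewrite sortCols≡sort (List.map flipCol cs) = sort-↭ (List.map flipCol cs)

transposeB-involutive : ∀ {cs} → Sorted cs → transposeB (transposeB cs) ≡ cs
transposeB-involutive {cs} cs↗ = sorted-↭-unique (transposeB-↗ (transposeB cs)) cs↗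
  (↭-trans (transposeB-↭ (transposeB cs))
           (subst (List.map flipCol (transposeB cs) ↭_) (map-flipCol-involutive cs)
                  (map⁺ flipCol (transposeB-↭ cs))))

DesStep⇒⊴ : ∀ {x y} → proj₁ x ≤ proj₁ y → DesStep x y → x ⊴ y
DesStep⇒⊴ a≤c des with ℕ.m≤n⇒m<n∨m≡n a≤c
... | inj₁ a<c  = inj₁ a<c
... | inj₂ refl = inj₂ (refl , des ℕ.≤-refl)

Bur⇒Sorted : ∀ {n cs} → Bur n cs → Sorted cs
Bur⇒Sorted (_ , _ , tops↗ , _ , des) = Linked.zipWith (λ (p , q) → DesStep⇒⊴ p q) (map⁻ tops↗ , des)

SameRowOrder : (Column → ℕ) → Column × Column → Column × Column → Set
SameRowOrder row (x , y) (x′ , y′) =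
  ((row x < row x′) ⇔ (row y < row y′)) × ((row x ≡ row x′) ⇔ (row y ≡ row y′))

SameOrder : Column × Column → Column × Column → Set
SameOrder p q = SameRowOrder proj₁ p q × SameRowOrder proj₂ p q

OrderIsomorphic : List (Column × Column) → Set
OrderIsomorphic Z = ∀ {p q} → p ∈ Z → q ∈ Z → SameOrder p q

⊴-transfer : ∀ {a b c d a′ b′ c′ d′} →
             (a < c → a′ < c′) → (a ≡ c → a′ ≡ c′) → (b′ < d′ → b < d) →
             (a , b) ⊴ (c , d) → (a′ , b′) ⊴ (c′ , d′)
⊴-transfer <-to _    _      (inj₁ a<c)         = inj₁ (<-to a<c)
⊴-transfer _    ≡-to <-from (inj₂ (a≡c , d≤b)) =
  inj₂ (≡-to a≡c , ℕ.≮⇒≥ (λ b′<d′ → ℕ.<⇒≱ (<-from b′<d′) d≤b))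

SameOrder⇒OrderAgree : ∀ {p q} → SameOrder p q → OrderAgree p q
SameOrder⇒OrderAgree ((<₁ , ≡₁) , (<₂ , _)) = mk⇔
  (⊴-transfer (to <₁) (to ≡₁) (from <₂))
  (⊴-transfer (from <₁) (from ≡₁) (to <₂))
  where open Equivalence

OrderIsomorphic-flip : ∀ {xs ys} (e : Embedding xs ys) → OrderIsomorphic (matched e) →
                       OrderIsomorphic (matched (map-embedding flipCol e))
OrderIsomorphic-flip e iso p∈ q∈
  rewrite matched-map-embedding flipCol e
  with ∈-map⁻ _ p∈ | ∈-map⁻ _ q∈
... | _ , p₀∈ , refl | _ , q₀∈ , refl = Prod.swap (iso p₀∈ q₀∈)

≼⇒Embedding : ∀ {S T} → S ≼ T → Σ (Embedding S T) λ e → OrderIsomorphic (matched e)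
≼⇒Embedding {S} {T} (f , f-mono , iso₁ , iso₂) = e , λ p∈ q∈ →
  let i , p≡ = e-at p∈ ; j , q≡ = e-at q∈
  in subst₂ SameOrder (sym p≡) (sym q≡) (iso₁ i j , iso₂ i j)
  where
  rec = embeddingAt S T f (λ {i} {j} → f-mono i j)
  e = proj₁ rec
  e-at = proj₂ rec

Embedding⇒≼ : ∀ {S T} (e : Embedding S T) → OrderIsomorphic (matched e) → S ≼ T
Embedding⇒≼ e iso = positions e , (λ _ _ → positions-mono e) ,
  (λ i j → proj₁ (iso (lookup-positions-∈ e i) (lookup-positions-∈ e j))) ,
  (λ i j → proj₂ (iso (lookup-positions-∈ e i) (lookup-positions-∈ e j)))

transposeB-mono-≼ : ∀ S T → S ≼ T → transposeB S ≼ transposeB T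
transposeB-mono-≼ S T S≼T =
  subst₂ _≼_ (sym (sortCols≡sort (List.map flipCol S))) (sym (sortCols≡sort (List.map flipCol T)))
    (Embedding⇒≼ e′ (λ p∈ q∈ → iso (e′⊆ p∈) (e′⊆ q∈)))
  where
  occurrence = ≼⇒Embedding {S} {T} S≼T
  e = proj₁ occurrence
  iso = OrderIsomorphic-flip e (proj₂ occurrence)
  sorted = sort-embedding (map-embedding flipCol e) (λ p∈ q∈ → SameOrder⇒OrderAgree (iso p∈ q∈))
  e′ = proj₁ sorted
  e′⊆ = proj₂ sorted

mainTheorem13 : (n k : ℕ) (ux vy : TwoLine) → Bur n ux → Bur k vy →
    (vy ≼ ux) ⇔ (transposeB vy ≼ transposeB ux)
mainTheorem13 n k ux vy ux-Bur vy-Bur = mk⇔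
  (transposeB-mono-≼ vy ux)
  (λ h → subst₂ _≼_ (transposeB-involutive (Bur⇒Sorted vy-Bur))
                    (transposeB-involutive (Bur⇒Sorted ux-Bur))
                    (transposeB-mono-≼ (transposeB vy) (transposeB ux) h))
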